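{- Let $S$ be a string and let $x$ be an implicit suffix node in the suffix tree of $S$. Then the distance between $x$ and $par(x)$ is not bigger than the length of any leaf edge of the suffix tree.
   Context: The suffix tree of a string $S$ (not necessarily ending with a unique end symbol) is the compacted trie of all suffixes of $S$. Explicit nodes: the root, branching nodes and leaves; implicit nodes: positions inside edges. The label of a node is the string on the path from the root to it, and its length is its string depth. A suffix node is a node whose label is a suffix of $S$. For a node $x$, $par(x)$ is the deepest explicit node on the path from the root to $x$, excluding $x$. The distance between a node and one of its ancestors is the difference of their string depths. A leaf edge is an edge ending at a leaf; its length is the number of letters on it. -}

module Defs where

open import Data.List using (List; []; _∷_; _++_; [_]; length)
open import Data.Nat using (ℕ; _≤_)
open import Data.Product using (Σ; ∃; ∃-syntax; _×_; _,_)
open import Data.Sum using (_⊎_)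
open import Relation.Nullary using (¬_)
open import Relation.Binary.PropositionalEquality using (_≡_; _≢_)

-- Nodes of the suffix tree of S (explicit or implicit) are identified with
-- their labels: exactly the factors (substrings) of S. The root is [].
module _ {A : Set} (S : List A) where

  Factor : List A → Set
  Factor w = ∃[ u ] ∃[ v ] (S ≡ u ++ w ++ v)

  Suffix : List A → Set
  Suffix w = ∃[ u ] (S ≡ u ++ w)

  Branching : List A → Set
  Branching w = Factor w × ∃[ a ] ∃[ b ] (a ≢ b × Factor (w ++ [ a ]) × Factor (w ++ [ b ]))

  Leaf : List A → Set
  Leaf w = Factor w × w ≢ [] × (∀ a → ¬ Factor (w ++ [ a ]))

  Explicit : List A → Set
  Explicit w = Factor w × (w ≡ [] ⊎ Branching w ⊎ Leaf w)

  Implicit : List A → Set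
  Implicit w = Factor w × ¬ Explicit w

  -- p is a proper prefix of x, i.e. a proper ancestor of x in the tree
  ProperPrefix : List A → List A → Set
  ProperPrefix p x = ∃[ w ] (w ≢ [] × p ++ w ≡ x)

  IsPar : List A → List A → Set
  IsPar x p = ProperPrefix p x × Explicit p ×
              (∀ q → ProperPrefix q x → Explicit q → length q ≤ length p)

  open import Data.Nat using (_∸_)
  dist : List A → List A → ℕ
  dist x p = length x ∸ length p

-- A leaf is not right-extensible, so it is a suffix of S; hence the suffix x
-- is comparable with the leaf l. If l were a suffix of x, then x could not be
-- extended either and would be a leaf. So l = y x with x = par(x) w, and par(l)
-- cannot lie strictly below y par(x): it is neither the root nor a leaf, so it
-- would branch, and stripping y would give a branching node strictly between
-- par(x) and x. Thus the leaf edge of l contains a copy of w.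
module Submission where

open import Defs
open import Data.List using (List; []; _∷_; _++_; [_]; length)
open import Data.List.Properties using (++-assoc; ++-identityʳ; ++-conicalʳ; length-++; ∷-injective)
open import Data.Nat using (_≤_; _+_; _∸_)
open import Data.Nat.Properties using (m+n∸m≡n; m≤n+m; m+1+n≰m; module ≤-Reasoning)
open import Data.Product using (∃-syntax; _×_; _,_; proj₁)
open import Data.Sum using (_⊎_; inj₁; inj₂)
open import Data.Empty using (⊥-elim)
open import Relation.Nullary using (¬_)
open import Relation.Binary.PropositionalEquality
  using (_≡_; _≢_; refl; sym; trans; cong; subst; module ≡-Reasoning)

module _ {A : Set} where

  ++-≡-++ : ∀ (a : List A) {b} c {d} → a ++ b ≡ c ++ d →
            (∃[ m ] (a ≡ c ++ m × d ≡ m ++ b)) ⊎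
            (∃[ m ] (m ≢ [] × c ≡ a ++ m × b ≡ m ++ d))
  ++-≡-++ a       []      eq = inj₁ (a , refl , sym eq)
  ++-≡-++ []      (y ∷ c) eq = inj₂ (y ∷ c , (λ ()) , refl , eq)
  ++-≡-++ (x ∷ a) (y ∷ c) eq with ∷-injective eq
  ... | refl , eq′ with ++-≡-++ a c eq′
  ...   | inj₁ (m , refl , d≡mb)        = inj₁ (m , refl , d≡mb)
  ...   | inj₂ (m , m≢[] , refl , b≡md) = inj₂ (m , m≢[] , refl , b≡md)

  ≢[]⇒length-++≰ : ∀ (p m : List A) → m ≢ [] → ¬ length (p ++ m) ≤ length p
  ≢[]⇒length-++≰ p []      m≢[] _ = m≢[] refl
  ≢[]⇒length-++≰ p (c ∷ m) _    pm≤p = m+1+n≰m (length p) (subst (_≤ length p) (length-++ p) pm≤p)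

module _ {A : Set} (S : List A) where

  Factor-infix : ∀ a w b → Factor S (a ++ w ++ b) → Factor S w
  Factor-infix a w b (u , v , S≡) = u ++ a , b ++ v , (begin
      S                           ≡⟨ S≡ ⟩
      u ++ (a ++ w ++ b) ++ v     ≡⟨ cong (u ++_) (++-assoc a (w ++ b) v) ⟩
      u ++ a ++ (w ++ b) ++ v     ≡⟨ cong (λ t → u ++ a ++ t) (++-assoc w b v) ⟩
      u ++ a ++ w ++ b ++ v       ≡⟨ sym (++-assoc u a (w ++ b ++ v)) ⟩
      (u ++ a) ++ w ++ b ++ v     ∎)
    where open ≡-Reasoning

  Factor-suffix : ∀ a w → Factor S (a ++ w) → Factor S w
  Factor-suffix a w f =
    Factor-infix a w [] (subst (λ t → Factor S (a ++ t)) (sym (++-identityʳ w)) f)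

  Factor-extendˡ : ∀ a w c → Factor S ((a ++ w) ++ [ c ]) → Factor S (w ++ [ c ])
  Factor-extendˡ a w c f = Factor-suffix a (w ++ [ c ]) (subst (Factor S) (++-assoc a w [ c ]) f)

  ProperPrefix⇒extensible : ∀ {q l} → ProperPrefix S q l → Factor S l →
                            ∃[ c ] Factor S (q ++ [ c ])
  ProperPrefix⇒extensible ([] , []≢[] , _) _ = ⊥-elim ([]≢[] refl)
  ProperPrefix⇒extensible {q} (c ∷ v , _ , refl) fl =
    c , Factor-infix [] (q ++ [ c ]) v (subst (Factor S) (sym (++-assoc q [ c ] v)) fl)

  Leaf⇒Suffix : ∀ {l} → Leaf S l → Suffix S l
  Leaf⇒Suffix {l} ((u , []    , S≡) , _) = u , trans S≡ (cong (u ++_) (++-identityʳ l))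
  Leaf⇒Suffix {l} ((u , c ∷ v , S≡) , _ , inextensible) =
    ⊥-elim (inextensible c (u , v , trans S≡ (cong (u ++_) (sym (++-assoc l [ c ] v)))))

  Leaf-extendˡ : ∀ m {l} → Factor S (m ++ l) → Leaf S l → Leaf S (m ++ l)
  Leaf-extendˡ m {l} f (_ , l≢[] , inextensible) =
    f , (λ ml≡[] → l≢[] (++-conicalʳ m l ml≡[])) ,
    (λ c fc → inextensible c (Factor-extendˡ m l c fc))

  Branching-suffix : ∀ y {r} → Branching S (y ++ r) → Branching S r
  Branching-suffix y {r} (f , a , b , a≢b , fa , fb) =
    Factor-suffix y r f , a , b , a≢b , Factor-extendˡ y r a fa , Factor-extendˡ y r b fb

  explicit-ancestor-branching : ∀ {q l} → ProperPrefix S q l → Factor S l →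
                                Explicit S q → q ≢ [] → Branching S q
  explicit-ancestor-branching _ _ (_ , inj₁ q≡[]) q≢[] = ⊥-elim (q≢[] q≡[])
  explicit-ancestor-branching _ _ (_ , inj₂ (inj₁ branching)) _ = branching
  explicit-ancestor-branching q<l fl (_ , inj₂ (inj₂ (_ , _ , inextensible))) _ =
    let c , fc = ProperPrefix⇒extensible q<l fl in ⊥-elim (inextensible c fc)

  dist-++ : ∀ p w → dist S (p ++ w) p ≡ length w
  dist-++ p w = trans (cong (_∸ length p) (length-++ p)) (m+n∸m≡n (length p) (length w))

  dist-IsPar-≤-extendˡ : ∀ y {x p l q} → l ≡ y ++ x → Factor S l → IsPar S x p →
                      ProperPrefix S q l → Explicit S q → dist S x p ≤ dist S l q
  dist-IsPar-≤-extendˡ y {p = p} {q = q} l≡yx fl ((w , _ , refl) , _ , deepest) (v , v≢[] , refl) explicit-q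
    with ++-≡-++ (y ++ p) q (trans (++-assoc y p w) (sym l≡yx))
  ... | inj₁ (m , _ , refl) = begin
    dist S (p ++ w) p        ≡⟨ dist-++ p w ⟩
    length w                 ≤⟨ m≤n+m (length w) (length m) ⟩
    length m + length w      ≡⟨ length-++ m ⟨
    length (m ++ w)          ≡⟨ dist-++ q (m ++ w) ⟨
    dist S (q ++ m ++ w) q   ∎
    where open ≤-Reasoning
  ... | inj₂ (m , m≢[] , refl , refl) =
    ⊥-elim (≢[]⇒length-++≰ p m m≢[] (deepest (p ++ m) p++m<x (proj₁ branching , inj₂ (inj₁ branching))))
    where
    ypm≢[] : (y ++ p) ++ m ≢ []
    ypm≢[] ypm≡[] = m≢[] (++-conicalʳ (y ++ p) m ypm≡[])
    branching : Branching S (p ++ m)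
    branching = Branching-suffix y (subst (Branching S) (++-assoc y p m)
      (explicit-ancestor-branching (v , v≢[] , refl) fl explicit-q ypm≢[]))
    p++m<x : ProperPrefix S (p ++ m) (p ++ m ++ v)
    p++m<x = v , v≢[] , ++-assoc p m v

lemma3 : {A : Set} (S : List A) (x p l q : List A) →
         Implicit S x → Suffix S x → IsPar S x p →
         Leaf S l → IsPar S l q →
         dist S x p ≤ dist S l q
lemma3 S x p l q (fx , ¬explicit-x) (u , S≡ux) par-x leaf-l (q<l , explicit-q , _)
  with Leaf⇒Suffix S leaf-l
... | ul , S≡ul++l with ++-≡-++ u ul (trans (sym S≡ux) S≡ul++l)
...   | inj₁ (y , _ , l≡yx) = dist-IsPar-≤-extendˡ S y l≡yx (proj₁ leaf-l) par-x q<l explicit-q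
...   | inj₂ (m , _ , _ , refl) =
  ⊥-elim (¬explicit-x (fx , inj₂ (inj₂ (Leaf-extendˡ S m fx leaf-l))))
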